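{- Let $I\subseteq\mathbb N$ be finite, let $E,F\subseteq\mathcal A_I$ be uniform edifices and let $\sigma$ be a feedback function. If $\overline{E}=\overline{F}$, then $\overline{\mathrm{Tr}_\sigma(E)}=\overline{\mathrm{Tr}_\sigma(F)}$ (bars denoting topological closure in the space of arches).
   Context: $W=\{\mathsf p,\mathsf q\}^*$ (finite words), $\mathcal C=\{\mathsf p,\mathsf q\}^{\mathbb N}$ (infinite words); for $s\in W\times W$ and $w\in\mathcal C\times\mathcal C$ (or $w\in W\times W$), $sw$ is componentwise concatenation. A pillar is $(u,i)$ with $u\in\mathcal C\times\mathcal C$, $i\in\mathbb N$ (based at $i$). An arch is an unordered pair of pillars; $\mathcal A$ is the set of arches and $\mathcal A_I$ the set of arches both of whose pillars are based in $I$. An edifice is a set of arches. The vault generated by $\{(s,i),(t,j)\}$ with $s,t\in W\times W$, $i,j\in\mathbb N$ is $\{\{(sw,i),(tw,j)\}:w\in\mathcal C\times\mathcal C\}$. An edifice $E$ is uniform iff every arch of $E$ belongs to some vault contained in $E$. A feedback function is a fixpoint-free partial involution $\sigma$ on $\mathbb N$ with finite domain. A trace sequence of $E$ along $\sigma$ is a non-empty finite sequence of arches of $E$, each written with a chosen order of its pillars as $\{(u_k,i_k),(v_k,j_k)\}$, $1\le k\le n$, with $j_{k-1}\in\mathrm{dom}\,\sigma$, $i_k=\sigma(j_{k-1})$ and $u_k=v_{k-1}$ for $2\le k\le n$; it is visible if $i_1,j_n\notin\mathrm{dom}\,\sigma$. $\mathrm{Tr}_\sigma(E)$ is the set of arches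 $\{(u_1,i_1),(v_n,j_n)\}$ over visible trace sequences of $E$ along $\sigma$. Topology: on $\mathcal C$, $d(x,y)=2^{ -k}$ with $k$ the length of the longest common prefix ($0$ if $x=y$); on pillars $d((x,y,i),(x',y',i'))=\max\{d(x,x'),d(y,y'),d_{disc}(i,i')\}$ with $d_{disc}(i,i')=0$ if $i=i'$ and $2$ otherwise; on arches $D(\{\xi,\upsilon\},\{\xi',\upsilon'\})=\min\{\max\{d(\xi,\xi'),d(\upsilon,\upsilon')\},\max\{d(\xi,\upsilon'),d(\upsilon,\xi')\}\}$. -}

module Defs where

open import Data.Nat using (ℕ; zero; suc; _<_)
open import Data.List using (List; []; _∷_)
open import Data.List.Membership.Propositional using (_∈_)
open import Data.Maybe using (Maybe; just; nothing)
open import Data.Product using (Σ; ∃; _×_; _,_; proj₁; proj₂)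
open import Data.Sum using (_⊎_)
open import Relation.Binary.PropositionalEquality using (_≡_; _≢_)

data Letter : Set where
  𝗉 𝗊 : Letter

W : Set
W = List Letter

𝒞 : Set
𝒞 = ℕ → Letter

_⊙_ : W → 𝒞 → 𝒞
([] ⊙ w) n = w n
((a ∷ s) ⊙ w) zero = a
((a ∷ s) ⊙ w) (suc n) = (s ⊙ w) n

_·_ : W × W → 𝒞 × 𝒞 → 𝒞 × 𝒞
(s₁ , s₂) · (w₁ , w₂) = (s₁ ⊙ w₁) , (s₂ ⊙ w₂)

_≈𝒞_ : 𝒞 → 𝒞 → Set
x ≈𝒞 y = ∀ n → x n ≡ y n

_≈²_ : 𝒞 × 𝒞 → 𝒞 × 𝒞 → Set
(x , y) ≈² (x' , y') = (x ≈𝒞 x') × (y ≈𝒞 y')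

Pillar : Set
Pillar = (𝒞 × 𝒞) × ℕ

base : Pillar → ℕ
base = proj₂

_≈P_ : Pillar → Pillar → Set
(u , i) ≈P (v , j) = (u ≈² v) × (i ≡ j)

-- An arch {ξ,υ} is represented by an ordered pair (ξ , υ);
-- arches are compared as unordered pairs (see _≈A_).
Arch : Set
Arch = Pillar × Pillar

_≈A_ : Arch → Arch → Set
(ξ , υ) ≈A (ξ' , υ') = ((ξ ≈P ξ') × (υ ≈P υ')) ⊎ ((ξ ≈P υ') × (υ ≈P ξ'))

-- An edifice is a set of arches, given as a predicate on representatives.
Edifice : Set₁
Edifice = Arch → Set

-- membership of an arch in an edifice (up to equality of unordered pairs of pillars)
_∈E_ : Arch → Edifice → Set
a ∈E E = Σ Arch λ b → E b × (b ≈A a)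

_⊆E_ : Edifice → Edifice → Set
E ⊆E F = ∀ a → a ∈E E → a ∈E F

_≡E_ : Edifice → Edifice → Set
E ≡E F = (E ⊆E F) × (F ⊆E E)

-- 𝒜_I : both pillars based in I  (I a finite subset of ℕ, given as a list)
InArchesOn : List ℕ → Edifice → Set
InArchesOn I E = ∀ a → a ∈E E → (base (proj₁ a) ∈ I) × (base (proj₂ a) ∈ I)

vault : W × W → ℕ → W × W → ℕ → Edifice
vault s i t j a = Σ (𝒞 × 𝒞) λ w → a ≈A (((s · w) , i) , ((t · w) , j))

Uniform : Edifice → Set
Uniform E = ∀ a → a ∈E E →
  Σ (W × W) λ s → Σ ℕ λ i → Σ (W × W) λ t → Σ ℕ λ j →
    (a ∈E vault s i t j) × (vault s i t j ⊆E E)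

record Feedback : Set where
  field
    σ         : ℕ → Maybe ℕ
    involutive : ∀ i j → σ i ≡ just j → σ j ≡ just i
    fixfree   : ∀ i j → σ i ≡ just j → i ≢ j
    finiteDom : Σ (List ℕ) λ D → ∀ i → σ i ≢ nothing → i ∈ D
open Feedback public

data TraceSeq (σ' : Feedback) (E : Edifice) : Pillar → Pillar → Set where
  single : ∀ ξ υ → (ξ , υ) ∈E E → TraceSeq σ' E ξ υ
  step   : ∀ ξ u v j i' ω → (ξ , ((v , j))) ∈E E →
           σ σ' j ≡ just i' → u ≈² v →
           TraceSeq σ' E (u , i') ω → TraceSeq σ' E ξ ω

Tr : Feedback → Edifice → Edifice
Tr σ' E (ξ , υ) = TraceSeq σ' E ξ υ × (σ σ' (base ξ) ≡ nothing) × (σ σ' (base υ) ≡ nothing)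

Agree : ℕ → 𝒞 → 𝒞 → Set
Agree n x y = ∀ k → k < n → x k ≡ y k

CloseP : ℕ → Pillar → Pillar → Set
CloseP n ((x , y) , i) ((x' , y') , i') = Agree n x x' × Agree n y y' × (i ≡ i')

-- D(a,b) < 2^{-n+1}, i.e. D(a,b) ≤ 2^{-n}, for n ≥ 1
CloseA : ℕ → Arch → Arch → Set
CloseA n (ξ , υ) (ξ' , υ') = (CloseP n ξ ξ' × CloseP n υ υ') ⊎ (CloseP n ξ υ' × CloseP n υ ξ')

closure : Edifice → Edifice
closure E a = ∀ n → Σ Arch λ b → (b ∈E E) × CloseA n a b

-- A uniform edifice is a union of vaults {(s w , i) , (t w , j)}, so its arches move
-- continuously: perturbing one pillar far enough into the common suffix w can be matched
-- by perturbing the other one. A visible trace sequence of E is approximated by one of F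
-- from its last arch backwards: the F-arch approximating an arch of E is chosen first,
-- and only then is the rest of the sequence approximated, starting near the pillar where
-- that F-arch ends and with the precision its own vault demands. Hence Tr_σ(E) lies in
-- the closure of Tr_σ(F), and symmetrically.
module Submission where

open import Defs
open import Data.List using (List; []; _∷_; length)
open import Data.Nat using (ℕ; zero; suc; _+_; _≤_; z≤n; s≤s)
open import Data.Nat.Properties using (<-≤-trans; <-trans; n<1+n; +-monoʳ-<; +-monoˡ-≤; m≤m+n; m≤n+m)
open import Data.Product using (Σ; _×_; _,_; proj₁; proj₂)
open import Data.Sum using (inj₁; inj₂)
open import Data.Maybe using (just; nothing)
open import Relation.Binary.PropositionalEquality using (_≡_; refl; sym; trans; cong)

private
  variable
    n m : ℕ
    x y z : 𝒞
    u v : 𝒞 × 𝒞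
    ξ ξ' υ ζ ω : Pillar
    a b c : Arch
    E F : Edifice
    σ' : Feedback

Agree-sym : Agree n x y → Agree n y x
Agree-sym x≈y k k<n = sym (x≈y k k<n)

Agree-trans : Agree n x y → Agree n y z → Agree n x z
Agree-trans x≈y y≈z k k<n = trans (x≈y k k<n) (y≈z k k<n)

Agree-mono : m ≤ n → Agree n x y → Agree m x y
Agree-mono m≤n x≈y k k<m = x≈y k (<-≤-trans k<m m≤n)

≈𝒞⇒Agree : x ≈𝒞 y → Agree n x y
≈𝒞⇒Agree x≈y k _ = x≈y k

≈²-sym : u ≈² v → v ≈² u
≈²-sym (e₁ , e₂) = (λ k → sym (e₁ k)) , (λ k → sym (e₂ k))

≈P-refl : ξ ≈P ξ
≈P-refl = ((λ _ → refl) , (λ _ → refl)) , refl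

≈P-sym : ξ ≈P υ → υ ≈P ξ
≈P-sym (e² , e) = ≈²-sym e² , sym e

≈P-trans : ξ ≈P υ → υ ≈P ζ → ξ ≈P ζ
≈P-trans ((e₁ , e₂) , e) ((f₁ , f₂) , f) =
  ((λ k → trans (e₁ k) (f₁ k)) , (λ k → trans (e₂ k) (f₂ k))) , trans e f

≈A-refl : a ≈A a
≈A-refl = inj₁ (≈P-refl , ≈P-refl)

≈A-swap : (ξ , υ) ≈A (υ , ξ)
≈A-swap = inj₂ (≈P-refl , ≈P-refl)

≈A-sym : a ≈A b → b ≈A a
≈A-sym (inj₁ (p , q)) = inj₁ (≈P-sym p , ≈P-sym q)
≈A-sym (inj₂ (p , q)) = inj₂ (≈P-sym q , ≈P-sym p)

≈A-trans : a ≈A b → b ≈A c → a ≈A c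
≈A-trans (inj₁ (p , q)) (inj₁ (p' , q')) = inj₁ (≈P-trans p p' , ≈P-trans q q')
≈A-trans (inj₁ (p , q)) (inj₂ (p' , q')) = inj₂ (≈P-trans p p' , ≈P-trans q q')
≈A-trans (inj₂ (p , q)) (inj₁ (p' , q')) = inj₂ (≈P-trans p q' , ≈P-trans q p')
≈A-trans (inj₂ (p , q)) (inj₂ (p' , q')) = inj₁ (≈P-trans p q' , ≈P-trans q p')

∈E-resp-≈A : a ∈E E → a ≈A b → b ∈E E
∈E-resp-≈A (c , Ec , c≈a) a≈b = c , Ec , ≈A-trans c≈a a≈b

∈E-swap : (ξ , υ) ∈E E → (υ , ξ) ∈E E
∈E-swap mem = ∈E-resp-≈A mem ≈A-swap

CloseP-refl : CloseP n ξ ξ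
CloseP-refl = (λ _ _ → refl) , (λ _ _ → refl) , refl

CloseP-sym : CloseP n ξ υ → CloseP n υ ξ
CloseP-sym (a₁ , a₂ , e) = Agree-sym a₁ , Agree-sym a₂ , sym e

CloseP-trans : CloseP n ξ υ → CloseP n υ ζ → CloseP n ξ ζ
CloseP-trans (a₁ , a₂ , e) (b₁ , b₂ , f) = Agree-trans a₁ b₁ , Agree-trans a₂ b₂ , trans e f

CloseP-mono : m ≤ n → CloseP n ξ υ → CloseP m ξ υ
CloseP-mono m≤n (a₁ , a₂ , e) = Agree-mono m≤n a₁ , Agree-mono m≤n a₂ , e

CloseP-base : CloseP n ξ υ → base ξ ≡ base υ
CloseP-base (_ , _ , e) = e

CloseP-rebase : ∀ i → CloseP n ξ υ → CloseP n (proj₁ ξ , i) (proj₁ υ , i)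
CloseP-rebase i (a₁ , a₂ , _) = a₁ , a₂ , refl

≈P⇒CloseP : ξ ≈P υ → CloseP n ξ υ
≈P⇒CloseP ((e₁ , e₂) , e) = ≈𝒞⇒Agree e₁ , ≈𝒞⇒Agree e₂ , e

≈A⇒CloseA : a ≈A b → CloseA n a b
≈A⇒CloseA (inj₁ (p , q)) = inj₁ (≈P⇒CloseP p , ≈P⇒CloseP q)
≈A⇒CloseA (inj₂ (p , q)) = inj₂ (≈P⇒CloseP p , ≈P⇒CloseP q)

CloseA-trans : CloseA n a b → CloseA n b c → CloseA n a c
CloseA-trans (inj₁ (p , q)) (inj₁ (p' , q')) = inj₁ (CloseP-trans p p' , CloseP-trans q q')
CloseA-trans (inj₁ (p , q)) (inj₂ (p' , q')) = inj₂ (CloseP-trans p p' , CloseP-trans q q')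
CloseA-trans (inj₂ (p , q)) (inj₁ (p' , q')) = inj₂ (CloseP-trans p q' , CloseP-trans q p')
CloseA-trans (inj₂ (p , q)) (inj₂ (p' , q')) = inj₁ (CloseP-trans p q' , CloseP-trans q p')

suffix : W → 𝒞 → 𝒞
suffix s x k = x (length s + k)

⊙-length : ∀ s k → (s ⊙ x) (length s + k) ≡ x k
⊙-length []      k = refl
⊙-length (_ ∷ s) k = ⊙-length s k

⊙-Agree : ∀ s → Agree n x y → Agree n (s ⊙ x) (s ⊙ y)
⊙-Agree []      x≈y = x≈y
⊙-Agree (_ ∷ s) x≈y zero    _     = refl
⊙-Agree (_ ∷ s) x≈y (suc k) 1+k<n = ⊙-Agree s x≈y k (<-trans (n<1+n k) 1+k<n)

⊙-suffix : ∀ s → Agree (length s) x (s ⊙ y) → (s ⊙ suffix s x) ≈𝒞 x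
⊙-suffix []      _   k       = refl
⊙-suffix (_ ∷ s) x≈y zero    = sym (x≈y zero (s≤s z≤n))
⊙-suffix (_ ∷ s) x≈y (suc k) = ⊙-suffix s (λ k k<n → x≈y (suc k) (s≤s k<n)) k

suffix-Agree : ∀ s → Agree (length s + n) x (s ⊙ y) → Agree n (suffix s x) y
suffix-Agree s x≈y k k<n = trans (x≈y (length s + k) (+-monoʳ-< (length s) k<n)) (⊙-length s k)

∣_∣ : W × W → ℕ
∣ s₁ , s₂ ∣ = length s₁ + length s₂

Agree² : ℕ → 𝒞 × 𝒞 → 𝒞 × 𝒞 → Set
Agree² n (x₁ , x₂) (y₁ , y₂) = Agree n x₁ y₁ × Agree n x₂ y₂

·-factor : ∀ s → Agree² (∣ s ∣ + n) u (s · v) →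
           Σ (𝒞 × 𝒞) λ w → (s · w) ≈² u × Agree² n w v
·-factor {n} {u₁ , u₂} (s₁ , s₂) (a₁ , a₂) =
  (suffix s₁ u₁ , suffix s₂ u₂) ,
  (⊙-suffix s₁ (Agree-mono (m≤m+n (length s₁) n) a₁₊) ,
   ⊙-suffix s₂ (Agree-mono (m≤m+n (length s₂) n) a₂₊)) ,
  suffix-Agree s₁ a₁₊ , suffix-Agree s₂ a₂₊
  where
  a₁₊ = Agree-mono (+-monoˡ-≤ n (m≤m+n (length s₁) (length s₂))) a₁
  a₂₊ = Agree-mono (+-monoˡ-≤ n (m≤n+m (length s₂) (length s₁))) a₂

·-CloseP : ∀ t {j} → Agree² n u v → CloseP n (t · u , j) (t · v , j)
·-CloseP (t₁ , t₂) (a₁ , a₂) = ⊙-Agree t₁ a₁ , ⊙-Agree t₂ a₂ , refl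

record VaultThrough (E : Edifice) (ξ υ : Pillar) : Set where
  field
    s t : W × W
    i j : ℕ
    w   : 𝒞 × 𝒞
    ξ≈  : ξ ≈P (s · w , i)
    υ≈  : υ ≈P (t · w , j)
    ⊆E  : ∀ w' → ((s · w' , i) , (t · w' , j)) ∈E E

∈vault : ∀ s i t j w → ((s · w , i) , (t · w , j)) ∈E vault s i t j
∈vault s i t j w = _ , (w , ≈A-refl) , ≈A-refl

uniform⇒vaultThrough : Uniform E → (ξ , υ) ∈E E → VaultThrough E ξ υ
uniform⇒vaultThrough U mem with U _ mem
... | s , i , t , j , (_ , (w , b≈v) , b≈a) , vault⊆E with ≈A-trans (≈A-sym b≈a) b≈v
...   | inj₁ (ξ≈ , υ≈) = record
  { s = s ; t = t ; i = i ; j = j ; w = w ; ξ≈ = ξ≈ ; υ≈ = υ≈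
  ; ⊆E = λ w' → vault⊆E _ (∈vault s i t j w') }
...   | inj₂ (ξ≈ , υ≈) = record
  { s = t ; t = s ; i = j ; j = i ; w = w ; ξ≈ = ξ≈ ; υ≈ = υ≈
  ; ⊆E = λ w' → ∈E-swap (vault⊆E _ (∈vault s i t j w')) }

uniform-extend : Uniform E → (ξ , υ) ∈E E → ∀ n → Σ ℕ λ m →
                 ∀ ξ' → CloseP m ξ' ξ → Σ Pillar λ υ' → (ξ' , υ') ∈E E × CloseP n υ' υ
uniform-extend {E} {ξ} {υ} U mem n =
  ∣ s ∣ + n , λ ξ' ξ'≈ξ → extend ξ' (CloseP-trans ξ'≈ξ (≈P⇒CloseP ξ≈))
  where
  open VaultThrough (uniform⇒vaultThrough U mem)
  extend : ∀ ξ' → CloseP (∣ s ∣ + n) ξ' (s · w , i) →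
           Σ Pillar λ υ' → (ξ' , υ') ∈E E × CloseP n υ' υ
  extend (u , _) (a₁ , a₂ , refl) =
    let w' , s·w'≈u , w'≈w = ·-factor s (a₁ , a₂)
    in (t · w' , j) ,
       ∈E-resp-≈A (⊆E w') (inj₁ ((s·w'≈u , refl) , ≈P-refl)) ,
       CloseP-trans (·-CloseP t w'≈w) (≈P⇒CloseP (≈P-sym υ≈))

⊆closure : a ∈E E → a ∈E closure E
⊆closure {a} mem = a , (λ n → a , mem , ≈A⇒CloseA ≈A-refl) , ≈A-refl

⊆closure⇒closure⊆ : (∀ {a} → E a → closure F a) → closure E ⊆E closure F
⊆closure⇒closure⊆ E⊆F̄ _ (b , b∈Ē , b≈a) = b , b∈F̄ , b≈a
  where
  b∈F̄ : closure _ b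
  b∈F̄ n =
    let c , (c' , Ec' , c'≈c) , b~c = b∈Ē n
        d , d∈F , c'~d = E⊆F̄ Ec' n
    in d , d∈F , CloseA-trans b~c (CloseA-trans (≈A⇒CloseA (≈A-sym c'≈c)) c'~d)

closure⊆⇒approxArch : closure E ⊆E closure F → (ξ , υ) ∈E E → ∀ l n →
  Σ Pillar λ β₁ → Σ Pillar λ β₂ → (β₁ , β₂) ∈E F × CloseP l β₁ ξ × CloseP n β₂ υ
closure⊆⇒approxArch Ē⊆F̄ mem l n with Ē⊆F̄ _ (⊆closure mem)
... | b , b∈F̄ , b≈a with b∈F̄ (l + n)
... | c , c∈F , b~c with CloseA-trans (≈A⇒CloseA (≈A-sym b≈a)) b~c
... | inj₁ (p , q) =
  _ , _ , c∈F , CloseP-mono (m≤m+n l n) (CloseP-sym p) , CloseP-mono (m≤n+m n l) (CloseP-sym q)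
... | inj₂ (p , q) =
  _ , _ , ∈E-swap c∈F , CloseP-mono (m≤m+n l n) (CloseP-sym p) , CloseP-mono (m≤n+m n l) (CloseP-sym q)

TraceNear : Feedback → Edifice → ℕ → ℕ → Pillar → Pillar → Set
TraceNear σ' F l n ξ ω =
  Σ Pillar λ ξ' → Σ Pillar λ ω' → CloseP l ξ' ξ × CloseP n ω' ω × TraceSeq σ' F ξ' ω'

TraceNear-respˡ : ∀ {l} → CloseP l ξ ξ' → TraceNear σ' F l n ξ ω → TraceNear σ' F l n ξ' ω
TraceNear-respˡ ξ≈ξ' (ζ , ω' , ζ≈ξ , ω'≈ω , tr) = ζ , ω' , CloseP-trans ζ≈ξ ξ≈ξ' , ω'≈ω , tr

-- The precision l at the start is fixed only after the perturbed start ξ': when an arch is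
-- prepended, it is dictated by the vault of the F-arch chosen to approximate that arch.
TraceApproximable : Feedback → Edifice → Pillar → Pillar → Set
TraceApproximable σ' F ξ ω =
  ∀ n → Σ ℕ λ m → ∀ ξ' → CloseP m ξ' ξ → ∀ l → TraceNear σ' F l n ξ' ω

trace-cons : ∀ {j} → (ξ , (proj₁ ζ , j)) ∈E F → σ σ' j ≡ just (base ζ) →
             TraceSeq σ' F ζ ω → TraceSeq σ' F ξ ω
trace-cons mem σj tr = step _ _ _ _ _ _ mem σj ((λ _ → refl) , (λ _ → refl)) tr

TraceNear-cons : ∀ {β₁ β₂ i} → Uniform F → (β₁ , β₂) ∈E F → σ σ' (base β₂) ≡ just i →
  (∀ k → TraceNear σ' F k n (proj₁ β₂ , i) ω) → ∀ l → TraceNear σ' F l n β₁ ω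
TraceNear-cons {β₂ = β₂} U β∈F σβ₂ near l =
  let k , extend = uniform-extend U (∈E-swap β∈F) l
      ζ , ω' , ζ≈ , ω'≈ω , tr = near k
      β₁' , mem , β₁'≈β₁ = extend (proj₁ ζ , base β₂) (CloseP-rebase (base β₂) ζ≈)
  in β₁' , ω' , β₁'≈β₁ , ω'≈ω ,
     trace-cons (∈E-swap mem) (trans σβ₂ (cong just (sym (CloseP-base ζ≈)))) tr

module _ (UE : Uniform E) (UF : Uniform F) (Ē⊆F̄ : closure E ⊆E closure F) where

  TraceApproximable-single : (ξ , ω) ∈E E → TraceApproximable σ' F ξ ω
  TraceApproximable-single mem n =
    let m , extend = uniform-extend UE mem n
    in m , λ ξ' ξ'≈ξ l →
      let υ' , mem' , υ'≈ω = extend ξ' ξ'≈ξ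
          β₁ , β₂ , β∈F , β₁≈ξ' , β₂≈υ' = closure⊆⇒approxArch Ē⊆F̄ mem' l n
      in β₁ , β₂ , β₁≈ξ' , CloseP-trans β₂≈υ' υ'≈ω , single β₁ β₂ β∈F

  TraceApproximable-cons : ∀ {j i} → (ξ , (v , j)) ∈E E → σ σ' j ≡ just i → u ≈² v →
    TraceApproximable σ' F (u , i) ω → TraceApproximable σ' F ξ ω
  TraceApproximable-cons {σ' = σ'} {i = i} mem σj u≈v approx n =
    let m , near = approx n
        m₀ , extend = uniform-extend UE mem m
    in m₀ , λ ξ' ξ'≈ξ l →
      let υ' , mem' , υ'≈v = extend ξ' ξ'≈ξ
          β₁ , β₂ , β∈F , β₁≈ξ' , β₂≈υ' = closure⊆⇒approxArch Ē⊆F̄ mem' l m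
          β₂≈v = CloseP-trans β₂≈υ' υ'≈v
          β₂≈u = CloseP-trans (CloseP-rebase i β₂≈v) (≈P⇒CloseP (≈²-sym u≈v , refl))
      in TraceNear-respˡ β₁≈ξ'
           (TraceNear-cons UF β∈F (trans (cong (σ σ') (CloseP-base β₂≈v)) σj) (near _ β₂≈u) l)

  trace-approximable : TraceSeq σ' E ξ ω → TraceApproximable σ' F ξ ω
  trace-approximable (single _ _ mem)               = TraceApproximable-single mem
  trace-approximable (step _ _ _ _ _ _ mem σj u≈v tr) =
    TraceApproximable-cons mem σj u≈v (trace-approximable tr)

  Tr⊆closureTr : ∀ {σ'} → Tr σ' E a → closure (Tr σ' F) a
  Tr⊆closureTr {σ' = σ'} (tr , ξ-visible , ω-visible) n =
    let _ , near = trace-approximable tr n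
        ξ' , ω' , ξ'≈ξ , ω'≈ω , tr' = near _ CloseP-refl n
        visible : ∀ {ζ ζ'} → CloseP n ζ' ζ → σ σ' (base ζ) ≡ nothing → σ σ' (base ζ') ≡ nothing
        visible ζ'≈ζ = trans (cong (σ σ') (CloseP-base ζ'≈ζ))
    in (ξ' , ω') , ((ξ' , ω') , (tr' , visible ξ'≈ξ ξ-visible , visible ω'≈ω ω-visible) , ≈A-refl) ,
       inj₁ (CloseP-sym ξ'≈ξ , CloseP-sym ω'≈ω)

proposition4p11 : (I : List ℕ) (E F : Edifice) (σ' : Feedback) →
    InArchesOn I E → InArchesOn I F → Uniform E → Uniform F →
    closure E ≡E closure F → closure (Tr σ' E) ≡E closure (Tr σ' F)
proposition4p11 I E F σ' _ _ UE UF (Ē⊆F̄ , F̄⊆Ē) =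
  ⊆closure⇒closure⊆ (Tr⊆closureTr UE UF Ē⊆F̄) , ⊆closure⇒closure⊆ (Tr⊆closureTr UF UE F̄⊆Ē)
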